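{- Let $(\Sigma, I, \to, \preceq)$ be a well-structured transition system and $P \subseteq \Sigma$ a downward-closed set such that $\mathrm{Cover}_k \cap (\Sigma \setminus P) \neq \emptyset$ for some $k \in \mathbb{N}$. Then for every derivation $\mathsf{Init} \mapsto \sigma_1 \mapsto \cdots \mapsto \sigma_n$ in the restricted rule system described in the context, there are at most $k$ different indices $i$ such that $\sigma_i \mapsto \sigma_{i+1}$ is an application of the rule Unfold.
   Context: A well-structured transition system (WSTS) $(\Sigma, I, \to, \preceq)$ consists of a set $\Sigma$ of states, a finite set $I \subseteq \Sigma$ of initial states, a relation $\to \subseteq \Sigma \times \Sigma$, and a well-quasi-order $\preceq$ on $\Sigma$ such that whenever $s_1 \to s_2$ and $s_1 \preceq t_1$, there is $t_2$ with $t_1 \to^{*} t_2$ and $s_2 \preceq t_2$. For $Y \subseteq \Sigma$, $\uparrow Y = \{x \mid \exists y \in Y,\ y \preceq x\}$ and $\downarrow Y = \{x \mid \exists y \in Y,\ x \preceq y\}$; $\uparrow x = \uparrow\{x\}$. For $X \subseteq \Sigma$, $\mathrm{pre}(X) = \{y \mid \exists x \in X,\ y \to x\}$. $\mathrm{Reach}_k$ is the set of states reachable from some state of $I$ in at most $k$ steps, and $\mathrm{Cover}_k = \downarrow \mathrm{Reach}_k$. For $Y \subseteq \Sigma$, $\min Y$ denotes a set of representatives of the minimal elements of $Y$ (one per equivalence class of $\preceq \cap \succeq$). Define $U_0 = \Sigma \setminus P$, $U_{i+1} = U_i \cup \mathrm{pre}(U_i)$, $D_0 = \min(\Sigma \setminus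 P)$ and $D_{i+1} = \bigcup_{a \in D_i} \min(\mathrm{pre}(\uparrow a)) \setminus U_i$. The restricted rule system. Its states are $\mathsf{Init}$, $\mathsf{valid}$, $\mathsf{invalid}$, and pairs $\mathbf{R} \mid Q$ where $\mathbf{R} = (R_0, \ldots, R_N)$ ($N \ge 0$, the length) is a vector of downward-closed subsets of $\Sigma$ and $Q$ is a finite priority queue of pairs $\langle a, i\rangle \in \Sigma \times \mathbb{N}$ with priority $i$; $\min Q$ is an element of least priority, $\mathrm{popMin}(Q)$ removes it, $\mathrm{push}(Q,x)$ adds $x$. $\mathrm{Gen}_i(a) = \{ b \mid b \preceq a,\ \uparrow b \cap I = \emptyset,\ \mathrm{pre}(\uparrow b) \cap (R_i \setminus \uparrow b) = \emptyset\}$, and $\mathbf{R}[R_k \gets R'_k]_{k=1}^i = (R_0, R'_1, \ldots, R'_i, R_{i+1}, \ldots, R_N)$. Rules: (Initialize) $\mathsf{Init} \mapsto (\downarrow I) \mid \emptyset$ (length $0$, $R_0 = \downarrow I$). (Candidate) if $a \in R_N \cap D_0$: $\mathbf{R} \mid \emptyset \mapsto \mathbf{R} \mid \{\langle a, N\rangle\}$. (ModelSyn) if $\min Q = \langle a, 0\rangle$: $\mathbf{R}\mid Q \mapsto \mathsf{invalid}$. (ModelSem) if $\min Q = \langle a, i\rangle$ and $I \cap \uparrow a \neq \emptyset$: $\mathbf{R}\mid Q \mapsto \mathsf{invalid}$. (Decide) if $\min Q = \langle a, i \rangle$, $i > 0$, $b \in D_{N-i+1} \cap R_{i-1}$ and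 $b \to a$: $\mathbf{R}\mid Q \mapsto \mathbf{R} \mid \mathrm{push}(Q, \langle b, i-1\rangle)$. (Conflict) if $\min Q = \langle a, i\rangle$, $i>0$, $\mathrm{pre}(\uparrow a) \cap (R_{i-1}\setminus \uparrow a) = \emptyset$ and $b \in \mathrm{Gen}_{i-1}(a)$: $\mathbf{R}\mid Q \mapsto \mathbf{R}[R_k \gets R_k \setminus \uparrow b]_{k=1}^{i} \mid \mathrm{popMin}(Q)$. (Induction) if $R_i = \Sigma \setminus \uparrow\{r_{i,1}, \ldots, r_{i,m}\}$ and $b \in \mathrm{Gen}_i(r_{i,j})$ for some $j$: $\mathbf{R} \mid \emptyset \mapsto \mathbf{R}[R_k \gets R_k \setminus \uparrow b]_{k=1}^{i+1} \mid \emptyset$. (Valid) if $R_i = R_{i+1}$ for some $i < N$: $\mathbf{R}\mid Q \mapsto \mathsf{valid}$. (Unfold) if $R_N \subseteq P$: $\mathbf{R} \mid \emptyset \mapsto (R_0, \ldots, R_N, \Sigma) \mid \emptyset$. -}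

module Defs where

open import Level using (0ℓ) renaming (suc to lsuc)
open import Data.Nat using (ℕ; zero; suc; _≤_; _<_; _∸_; _+_; _≤?_)
open import Data.Fin using (Fin; zero; suc; toℕ; fromℕ; inject₁)
open import Data.Product using (Σ; ∃; ∃₂; _×_; _,_; proj₁; proj₂)
open import Data.Sum using (_⊎_)
open import Data.List using (List; []; _∷_)
open import Data.List.Membership.Propositional renaming (_∈_ to _∈L_)
open import Data.List.Relation.Unary.All using (All)
open import Data.List.Relation.Binary.Permutation.Propositional using (_↭_)
open import Relation.Binary using (Rel; IsPreorder)
open import Relation.Binary.PropositionalEquality using (_≡_)
open import Relation.Binary.Construct.Closure.ReflexiveTransitive using (Star; ε; _◅_)
open import Relation.Nullary using (¬_; yes; no)
open import Relation.Unary using (Pred; _∩_; _∪_; _∖_; ∁; Empty; _≐_; _⊆_)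

WellQuasi : {A : Set} → Rel A 0ℓ → Set
WellQuasi {A} _≼_ = (f : ℕ → A) → ∃₂ λ i j → i < j × f i ≼ f j

record WSTS : Set₁ where
  field
    State      : Set
    I          : List State
    _⟶_        : Rel State 0ℓ
    _≼_        : Rel State 0ℓ
    isPreorder : IsPreorder _≡_ _≼_
    wqo        : WellQuasi _≼_
    compatible : ∀ {s₁ s₂ t₁} → s₁ ⟶ s₂ → s₁ ≼ t₁ →
                 ∃ λ t₂ → Star _⟶_ t₁ t₂ × s₂ ≼ t₂

module Basics (W : WSTS) where
  open WSTS W

  ↑ : State → Pred State 0ℓ
  ↑ y x = y ≼ x

  pre : Pred State 0ℓ → Pred State 0ℓ
  pre X y = ∃ λ x → X x × y ⟶ x

  DownClosed : Pred State 0ℓ → Set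
  DownClosed X = ∀ {x y} → x ≼ y → X y → X x

  _≈_ : Rel State 0ℓ
  x ≈ y = x ≼ y × y ≼ x

  Reach : ℕ → Pred State 0ℓ
  Reach zero x    = x ∈L I
  Reach (suc k) x = Reach k x ⊎ ∃ λ y → Reach k y × y ⟶ x

  Cover : ℕ → Pred State 0ℓ
  Cover k x = ∃ λ y → Reach k y × x ≼ y

  Minimal : Pred State 0ℓ → Pred State 0ℓ
  Minimal Y x = Y x × (∀ y → Y y → y ≼ x → x ≼ y)

  -- M is a set of representatives of the minimal elements of Y,
  -- one per equivalence class of ≼ ∩ ≽  (i.e. M is a choice of "min Y")
  MinRep : Pred State 0ℓ → Pred State 0ℓ → Set
  MinRep Y M = (∀ x → M x → Minimal Y x)
             × (∀ x → Minimal Y x → ∃ λ y → M y × y ≈ x)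
             × (∀ y z → M y → M z → y ≈ z → y ≡ z)

  record DSet : Set₁ where
    field
      set    : Pred State 0ℓ
      closed : DownClosed set
  open DSet public

  full : DSet
  full = record { set = λ _ → Data.Unit.Polymorphic.⊤ ; closed = λ _ _ → _ }
    where import Data.Unit.Polymorphic

  ↓I : DSet
  ↓I = record { set = λ x → ∃ λ s → s ∈L I × x ≼ s
              ; closed = λ { x≼y (s , s∈I , y≼s) →
                               s , s∈I , IsPreorder.trans isPreorder x≼y y≼s } }

  minusUp : DSet → State → DSet
  minusUp X b = record
    { set = set X ∖ ↑ b
    ; closed = λ { x≼y (Xy , b⋠y) →
                     closed X x≼y Xy , λ b≼x → b⋠y (IsPreorder.trans isPreorder b≼x x≼y) } }

module Rules (W : WSTS) (P : Pred (WSTS.State W) 0ℓ)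
             (minBad : Pred (WSTS.State W) 0ℓ)              -- min(Σ ∖ P)
             (minPre : WSTS.State W → Pred (WSTS.State W) 0ℓ) -- a ↦ min(pre(↑a))
             where
  open WSTS W
  open Basics W

  U : ℕ → Pred State 0ℓ
  U zero    = ∁ P
  U (suc i) = U i ∪ pre (U i)

  D : ℕ → Pred State 0ℓ
  D zero    = minBad
  D (suc i) = (λ x → ∃ λ a → D i a × minPre a x) ∖ U i

  -- Gen_i(a) where X = R_i
  Gen : DSet → State → Pred State 0ℓ
  Gen X a b = b ≼ a
            × (∀ s → s ∈L I → ¬ (b ≼ s))
            × Empty (pre (↑ b) ∩ (set X ∖ ↑ b))

  -- R[R_k ← R_k ∖ ↑b]_{k=1}^{i}
  update : ∀ {N} → (Fin (suc N) → DSet) → State → ℕ → Fin (suc N) → DSet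
  update R b i zero = R zero
  update R b i (suc k) with suc (toℕ k) ≤? i
  ... | yes _ = minusUp (R (suc k)) b
  ... | no _  = R (suc k)

  snoc : ∀ {N} → (Fin (suc N) → DSet) → DSet → Fin (suc (suc N)) → DSet
  snoc {zero}  R X zero          = R zero
  snoc {zero}  R X (suc zero)    = X
  snoc {suc N} R X zero          = R zero
  snoc {suc N} R X (suc k)       = snoc {N} (λ j → R (suc j)) X k

  Queue : Set
  Queue = List (State × ℕ)

  -- min Q = ⟨a , i⟩ and popMin Q = Q'
  MinSplit : Queue → State × ℕ → Queue → Set
  MinSplit Q (a , i) Q' = (Q ↭ ((a , i) ∷ Q')) × All (λ p → i ≤ proj₂ p) Q'

  data Config : Set₁ where
    Init valid invalid : Config
    ⟨_∣_⟩ : ∀ {N} → (Fin (suc N) → DSet) → Queue → Config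

  data RuleName : Set where
    Initialize Candidate ModelSyn ModelSem Decide Conflict Induction Valid Unfold : RuleName

  data Step : RuleName → Config → Config → Set₁ where
    initialize : Step Initialize Init (⟨_∣_⟩ {0} (λ _ → ↓I) [])
    candidate  : ∀ {N} {R : Fin (suc N) → DSet} {a} →
                 set (R (fromℕ N)) a → D zero a →
                 Step Candidate ⟨ R ∣ [] ⟩ ⟨ R ∣ (a , N) ∷ [] ⟩
    modelSyn   : ∀ {N} {R : Fin (suc N) → DSet} {Q Q' a} →
                 MinSplit Q (a , 0) Q' →
                 Step ModelSyn ⟨ R ∣ Q ⟩ invalid
    modelSem   : ∀ {N} {R : Fin (suc N) → DSet} {Q Q' a i} →
                 MinSplit Q (a , i) Q' →
                 (∃ λ s → s ∈L I × a ≼ s) →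
                 Step ModelSem ⟨ R ∣ Q ⟩ invalid
    -- i = j + 1 > 0, R_{i-1} = R_j, and N - i + 1 = N - j
    decide     : ∀ {N} {R : Fin (suc N) → DSet} {Q Q' a b} (j : Fin (suc N)) →
                 MinSplit Q (a , suc (toℕ j)) Q' →
                 D (N ∸ toℕ j) b → set (R j) b → b ⟶ a →
                 Step Decide ⟨ R ∣ Q ⟩ ⟨ R ∣ (b , toℕ j) ∷ Q ⟩
    -- i = j + 1 with 0 < i ≤ N, R_{i-1} = R_j
    conflict   : ∀ {N} {R : Fin (suc N) → DSet} {Q Q' a b} (j : Fin N) →
                 MinSplit Q (a , suc (toℕ j)) Q' →
                 Empty (pre (↑ a) ∩ (set (R (inject₁ j)) ∖ ↑ a)) →
                 Gen (R (inject₁ j)) a b →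
                 Step Conflict ⟨ R ∣ Q ⟩ ⟨ update R b (suc (toℕ j)) ∣ Q' ⟩
    -- i < N, R_i = Σ ∖ ↑{r_1, ..., r_m}
    induction  : ∀ {N} {R : Fin (suc N) → DSet} {b} (i : Fin N) (rs : List State) →
                 set (R (inject₁ i)) ≐ (λ x → ¬ (∃ λ r → r ∈L rs × r ≼ x)) →
                 (∃ λ r → r ∈L rs × Gen (R (inject₁ i)) r b) →
                 Step Induction ⟨ R ∣ [] ⟩ ⟨ update R b (suc (toℕ i)) ∣ [] ⟩
    valid      : ∀ {N} {R : Fin (suc N) → DSet} {Q} (i : Fin N) →
                 set (R (inject₁ i)) ≐ set (R (suc i)) →
                 Step Valid ⟨ R ∣ Q ⟩ valid
    unfold     : ∀ {N} {R : Fin (suc N) → DSet} →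
                 set (R (fromℕ N)) ⊆ P →
                 Step Unfold ⟨ R ∣ [] ⟩ ⟨ snoc R full ∣ [] ⟩

  _↦_ : Config → Config → Set₁
  σ ↦ σ' = Σ RuleName λ r → Step r σ σ'

  isUnfold : RuleName → ℕ
  isUnfold Unfold = 1
  isUnfold _      = 0

  unfoldCount : ∀ {σ σ'} → Star _↦_ σ σ' → ℕ
  unfoldCount ε              = 0
  unfoldCount ((r , _) ◅ d)  = isUnfold r + unfoldCount d

-- Every frame vector reached by the rules over-approximates the reachable
-- states level by level: Reach i ⊆ R i. Initialize establishes this, Unfold
-- appends Σ, and Conflict/Induction only remove cones ↑ b with b ∈ Gen(a),
-- which avoid Reach (i + 1) because they avoid I and every state of R i that
-- can step into them. Hence when Unfold fires at length N, Cover N ⊆ ↓ R N ⊆ P,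
-- so N < k; as each Unfold raises the length by one, at most k of them occur.
module Submission where

open import Defs
open import Level using (0ℓ)
open import Data.Nat using (ℕ; _≤_; _<_; _+_; zero; suc; z≤n; s≤s; _≤?_)
open import Data.Nat.Properties using (m≤n⇒m<n∨m≡n; m≤n⇒m≤1+n; ≰⇒>; +-suc; +-identityʳ)
open import Data.Fin using (Fin; zero; suc; toℕ; fromℕ; inject₁)
open import Data.Fin.Properties using (toℕ-inject₁; toℕ-fromℕ)
open import Data.Product using (∃; _×_; _,_)
open import Data.Sum using (inj₁; inj₂)
open import Data.List using ([])
open import Relation.Nullary using (¬_; yes; no)
open import Relation.Unary using (Pred; ∁; _⊆_)
open import Relation.Binary using (IsPreorder)
open import Relation.Binary.PropositionalEquality using (_≡_; refl; subst; sym)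
open import Relation.Binary.Construct.Closure.ReflexiveTransitive using (Star; ε; _◅_)

module ReachProperties (W : WSTS) where
  open WSTS W
  open Basics W

  Reach-mono : ∀ {m n} → m ≤ n → Reach m ⊆ Reach n
  Reach-mono {n = zero}  z≤n r = r
  Reach-mono {m} {suc n} m≤1+n r with m≤n⇒m<n∨m≡n m≤1+n
  ... | inj₁ (s≤s m≤n) = inj₁ (Reach-mono m≤n r)
  ... | inj₂ refl      = r

module FrameInvariant (W : WSTS) (P : Pred (WSTS.State W) 0ℓ)
                      (minBad : Pred (WSTS.State W) 0ℓ)
                      (minPre : WSTS.State W → Pred (WSTS.State W) 0ℓ) where
  open WSTS W
  open Basics W
  open Rules W P minBad minPre
  open ReachProperties W

  Gen-disjoint-Reach : ∀ (X : DSet) j {a b} → Reach j ⊆ set X → Gen X a b →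
                       ∀ m → m ≤ suc j → ∀ {x} → Reach m x → ¬ (b ≼ x)
  Gen-disjoint-Reach X j Reach⊆X (_ , b∉↑I , _) zero _ x∈I b≼x = b∉↑I _ x∈I b≼x
  Gen-disjoint-Reach X j Reach⊆X g (suc m) (s≤s m≤j) (inj₁ r) =
    Gen-disjoint-Reach X j Reach⊆X g m (m≤n⇒m≤1+n m≤j) r
  Gen-disjoint-Reach X j Reach⊆X g@(_ , _ , preb∩X≡∅) (suc m) (s≤s m≤j) {x} (inj₂ (y , y∈R , y⟶x)) b≼x =
    preb∩X≡∅ y ( (x , b≼x , y⟶x)
               , Reach⊆X (Reach-mono m≤j y∈R)
               , Gen-disjoint-Reach X j Reach⊆X g m (m≤n⇒m≤1+n m≤j) y∈R )

  OverapproxReach : ∀ {N} → (Fin (suc N) → DSet) → Set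
  OverapproxReach R = ∀ q → Reach (toℕ q) ⊆ set (R q)

  OverapproxReach-initial : OverapproxReach {0} (λ _ → ↓I)
  OverapproxReach-initial zero x∈I = _ , x∈I , IsPreorder.refl isPreorder

  OverapproxReach-update : ∀ {N} (R : Fin (suc N) → DSet) b i → OverapproxReach R →
                           (∀ m → m ≤ i → ∀ {x} → Reach m x → ¬ (b ≼ x)) →
                           OverapproxReach (update R b i)
  OverapproxReach-update R b i R⊇ b∉↑Reach zero r = R⊇ zero r
  OverapproxReach-update R b i R⊇ b∉↑Reach (suc q) r with suc (toℕ q) ≤? i
  ... | yes q<i = R⊇ (suc q) r , b∉↑Reach _ q<i r
  ... | no _    = R⊇ (suc q) r

  OverapproxReach-Gen : ∀ {N} (R : Fin (suc N) → DSet) (j : Fin N) {a b} →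
                        OverapproxReach R → Gen (R (inject₁ j)) a b →
                        OverapproxReach (update R b (suc (toℕ j)))
  OverapproxReach-Gen R j R⊇ g = OverapproxReach-update R _ _ R⊇ λ m m≤1+j →
    Gen-disjoint-Reach (R (inject₁ j)) (toℕ (inject₁ j)) (R⊇ (inject₁ j)) g m
      (subst (λ n → m ≤ suc n) (sym (toℕ-inject₁ j)) m≤1+j)

  snoc-full-⊇ : ∀ {N} (F : ℕ → Pred State 0ℓ) (R : Fin (suc N) → DSet) →
                (∀ q → F (toℕ q) ⊆ set (R q)) → ∀ q → F (toℕ q) ⊆ set (snoc R full q)
  snoc-full-⊇ {zero}  F R R⊇ zero       = R⊇ zero
  snoc-full-⊇ {zero}  F R R⊇ (suc zero) = _
  snoc-full-⊇ {suc N} F R R⊇ zero       = R⊇ zero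
  snoc-full-⊇ {suc N} F R R⊇ (suc q)    =
    snoc-full-⊇ (λ n → F (suc n)) (λ j → R (suc j)) (λ j → R⊇ (suc j)) q

  unfoldCount-valid : ∀ {σ} (d : Star _↦_ valid σ) → unfoldCount d ≡ 0
  unfoldCount-valid ε = refl
  unfoldCount-valid ((_ , ()) ◅ _)

  unfoldCount-invalid : ∀ {σ} (d : Star _↦_ invalid σ) → unfoldCount d ≡ 0
  unfoldCount-invalid ε = refl
  unfoldCount-invalid ((_ , ()) ◅ _)

  module _ (P-closed : DownClosed P) (k : ℕ) (bad : ∃ λ x → Cover k x × ¬ P x) where

    safe-frame-length< : ∀ {N} (R : Fin (suc N) → DSet) → OverapproxReach R →
                         set (R (fromℕ N)) ⊆ P → N < k
    safe-frame-length< {N} R R⊇ RN⊆P = ≰⇒> λ k≤N →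
      let (x , (y , y∈Reach , x≼y) , x∉P) = bad
          y∈ReachN = subst (λ n → Reach n y) (sym (toℕ-fromℕ N)) (Reach-mono k≤N y∈Reach)
      in x∉P (P-closed x≼y (RN⊆P (R⊇ (fromℕ N) y∈ReachN)))

    unfoldCount+length≤ : ∀ {N} (R : Fin (suc N) → DSet) Q {σ} → OverapproxReach R → N ≤ k →
                          (d : Star _↦_ ⟨ R ∣ Q ⟩ σ) → unfoldCount d + N ≤ k
    unfoldCount+length≤ R Q R⊇ N≤k ε = N≤k
    unfoldCount+length≤ R Q R⊇ N≤k ((_ , candidate _ _) ◅ d) = unfoldCount+length≤ R _ R⊇ N≤k d
    unfoldCount+length≤ R Q R⊇ N≤k ((_ , decide _ _ _ _ _) ◅ d) = unfoldCount+length≤ R _ R⊇ N≤k d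
    unfoldCount+length≤ R Q R⊇ N≤k ((_ , modelSyn _) ◅ d) rewrite unfoldCount-invalid d = N≤k
    unfoldCount+length≤ R Q R⊇ N≤k ((_ , modelSem _ _) ◅ d) rewrite unfoldCount-invalid d = N≤k
    unfoldCount+length≤ R Q R⊇ N≤k ((_ , valid _ _) ◅ d) rewrite unfoldCount-valid d = N≤k
    unfoldCount+length≤ R Q R⊇ N≤k ((_ , conflict j _ _ g) ◅ d) =
      unfoldCount+length≤ _ _ (OverapproxReach-Gen R j R⊇ g) N≤k d
    unfoldCount+length≤ R Q R⊇ N≤k ((_ , induction i _ _ (_ , _ , g)) ◅ d) =
      unfoldCount+length≤ _ _ (OverapproxReach-Gen R i R⊇ g) N≤k d
    unfoldCount+length≤ {N} R Q R⊇ N≤k ((_ , unfold RN⊆P) ◅ d) =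
      subst (_≤ k) (+-suc (unfoldCount d) N)
        (unfoldCount+length≤ (snoc R full) [] (snoc-full-⊇ Reach R R⊇)
           (safe-frame-length< R R⊇ RN⊆P) d)

    unfoldCount≤ : ∀ {σ} (d : Star _↦_ Init σ) → unfoldCount d ≤ k
    unfoldCount≤ ε = z≤n
    unfoldCount≤ ((_ , initialize) ◅ d) =
      subst (_≤ k) (+-identityʳ (unfoldCount d))
        (unfoldCount+length≤ (λ _ → ↓I) [] OverapproxReach-initial z≤n d)

lemma4 : (W : WSTS) (P : Pred (WSTS.State W) 0ℓ) →
    Basics.DownClosed W P →
    (k : ℕ) → (∃ λ x → Basics.Cover W k x × ¬ P x) →
    (minBad : Pred (WSTS.State W) 0ℓ) → Basics.MinRep W (∁ P) minBad →
    (minPre : WSTS.State W → Pred (WSTS.State W) 0ℓ) →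
    (∀ a → Basics.MinRep W (Basics.pre W (Basics.↑ W a)) (minPre a)) →
    (σ : Rules.Config W P minBad minPre) →
    (d : Star (Rules._↦_ W P minBad minPre) (Rules.Init {W} {P} {minBad} {minPre}) σ) →
    Rules.unfoldCount W P minBad minPre d ≤ k
lemma4 W P P-closed k bad minBad _ minPre _ σ d =
  FrameInvariant.unfoldCount≤ W P minBad minPre P-closed k bad d
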